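{- Let $\mathcal{G}$ be a finite partial Sherk plane, let $\ell$ be a line and $P$ a point not incident with $\ell$. Then either every line incident with $P$ is perpendicular to $\ell$, or there is exactly one line incident with $P$ and perpendicular to $\ell$.
   Context: A partial Sherk plane is a structure of points, lines, an incidence relation, and a binary relation $\perp$ on lines satisfying: (A*) two distinct points lie on at most one line; (B1) $\ell\perp m$ implies $m\perp\ell$; (B2) perpendicular lines intersect in at least one point; (B3) for any point $P$ and line $\ell$ there is at least one line through $P$ perpendicular to $\ell$; (B4) for any line $\ell$ and point $P$ on $\ell$ there is a unique line through $P$ perpendicular to $\ell$; (B5) there exist lines $x,y,z$ with $x\perp y$, $x\not\perp z$, $y\not\perp z$, and $x,y,z$ not all through a common point. Finite means finitely many points. -}

module Defs where

open import Data.Nat using (ℕ)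
open import Data.Fin using (Fin)
open import Data.Product using (Σ; ∃; _×_; Σ-syntax; ∃-syntax)
open import Relation.Binary.PropositionalEquality using (_≡_; _≢_)
open import Relation.Nullary using (¬_)

record PartialSherkPlane : Set₁ where
  field
    Point : Set
    Line  : Set
    _I_   : Point → Line → Set
    _⊥_   : Line → Line → Set
    axA*  : ∀ {P Q : Point} {l m : Line} → P ≢ Q →
            P I l → Q I l → P I m → Q I m → l ≡ m
    axB1  : ∀ {l m : Line} → l ⊥ m → m ⊥ l
    axB2  : ∀ {l m : Line} → l ⊥ m → ∃[ P ] (P I l × P I m)
    axB3  : ∀ (P : Point) (l : Line) → ∃[ m ] (P I m × m ⊥ l)
    axB4  : ∀ (l : Line) (P : Point) → P I l →
            Σ[ m ∈ Line ] ((P I m × m ⊥ l) ×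
              (∀ (m' : Line) → P I m' → m' ⊥ l → m' ≡ m))
    axB5  : Σ[ x ∈ Line ] Σ[ y ∈ Line ] Σ[ z ∈ Line ]
              (x ⊥ y × ¬ (x ⊥ z) × ¬ (y ⊥ z) ×
               ¬ (∃[ P ] (P I x × P I y × P I z)))

FinitePoints : PartialSherkPlane → Set
FinitePoints G = Σ[ n ∈ ℕ ] Σ[ f ∈ (Fin n → PartialSherkPlane.Point G) ]
                   (∀ (P : PartialSherkPlane.Point G) → ∃[ i ] (f i ≡ P))

module Submission where

open import Defs
open import Level using (0ℓ)
open import Axiom.ExcludedMiddle using (ExcludedMiddle)
open import Data.Product using (Σ; _×_; Σ-syntax)
open import Data.Sum using (_⊎_)
open import Relation.Binary.PropositionalEquality using (_≡_)
open import Relation.Nullary using (¬_)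

open import Axiom.DoubleNegationElimination using (em⇒dne)
open import Data.Empty using (⊥-elim)
open import Data.Fin using (Fin; toℕ)
open import Data.Fin.Properties using (pigeonhole)
open import Data.Nat using (ℕ; zero; suc)
open import Data.Nat.Properties using (n<1+n; <-irrefl)
open import Data.Product using (_,_; proj₁; proj₂; ∃-syntax)
open import Data.Sum using (inj₁; inj₂)
open import Relation.Binary.PropositionalEquality using (_≢_; refl; sym; trans; cong; subst)
open import Relation.Nullary using (Dec; yes; no)

-- Let P ∉ ℓ and suppose some line n through P is
-- not perpendicular to ℓ.  Dropping perpendiculars gives "feet": foot k X is
-- a point of k on a perpendicular to k through X.  The map
--     X ↦ foot n X   (X on ℓ),   X ↦ foot ℓ X   (X on n, not on ℓ),   X ↦ X   (otherwise)
-- is injective, because a perpendicular and a non-perpendicular to a line share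
-- at most one point.  If m is a perpendicular to ℓ through P meeting ℓ at Z,
-- then this map misses Z unless Z is the foot of P on ℓ.  An injective
-- self-map of a finite set is onto, so every perpendicular to ℓ through P
-- meets ℓ at foot ℓ P and, by (B4), is the chosen perpendicular: it is unique.

-- The iterates z, Θ z, Θ (Θ z), ... of a missed
-- point z would be pairwise distinct, contradicting the pigeonhole principle.
module _ {A : Set} (N : ℕ) (enum : Fin N → A) (onto : ∀ a → ∃[ i ] (enum i ≡ a))
         (Θ : A → A) (Θ-injective : ∀ x y → Θ x ≡ Θ y → x ≡ y) where

  index : A → Fin N
  index a = proj₁ (onto a)

  index-injective : ∀ a b → index a ≡ index b → a ≡ b
  index-injective a b e =
    trans (sym (proj₂ (onto a))) (trans (cong enum e) (proj₂ (onto b)))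

  iterate : A → ℕ → A
  iterate z zero    = z
  iterate z (suc k) = Θ (iterate z k)

  iterate-injective : ∀ {z} → (∀ x → Θ x ≢ z) →
                      ∀ i j → iterate z i ≡ iterate z j → i ≡ j
  iterate-injective misses zero    zero    e = refl
  iterate-injective misses zero    (suc j) e = ⊥-elim (misses _ (sym e))
  iterate-injective misses (suc i) zero    e = ⊥-elim (misses _ e)
  iterate-injective misses (suc i) (suc j) e =
    cong suc (iterate-injective misses i j (Θ-injective _ _ e))

  injective-endomap-misses-nothing : (z : A) → ¬ (∀ x → Θ x ≢ z)
  injective-endomap-misses-nothing z misses
    with i , j , i<j , same ← pigeonhole (n<1+n N) (λ k → index (iterate z (toℕ k)))
    = <-irrefl (iterate-injective misses _ _ (index-injective _ _ same)) i<j

module SherkGeometry (em : ExcludedMiddle 0ℓ) (G : PartialSherkPlane) where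
  open PartialSherkPlane G

  perpendicular-unique : ∀ {k a b Q} → Q I k →
                         Q I a → a ⊥ k → Q I b → b ⊥ k → a ≡ b
  perpendicular-unique {k} {a} {b} {Q} Qk Qa a⊥k Qb b⊥k =
    trans (unique a Qa a⊥k) (sym (unique b Qb b⊥k))
    where unique = proj₂ (proj₂ (axB4 k Q Qk))

  -- A line perpendicular to k and a line not perpendicular to k share at
  -- most one point: two common points would make the lines equal (A*).
  perpendicular-meets-nonperpendicular-once :
    ∀ {k a b X Y} → a ⊥ k → ¬ (b ⊥ k) →
    X I a → Y I a → X I b → Y I b → X ≡ Y
  perpendicular-meets-nonperpendicular-once a⊥k b⊥̸k Xa Ya Xb Yb =
    em⇒dne em (λ X≢Y → b⊥̸k (subst (_⊥ _) (axA* X≢Y Xa Ya Xb Yb) a⊥k))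

  perpTo : Line → Point → Line
  perpTo k X = proj₁ (axB3 X k)

  on-perpTo : ∀ k X → X I perpTo k X
  on-perpTo k X = proj₁ (proj₂ (axB3 X k))

  perpTo-⊥ : ∀ k X → perpTo k X ⊥ k
  perpTo-⊥ k X = proj₂ (proj₂ (axB3 X k))

  foot : Line → Point → Point
  foot k X = proj₁ (axB2 (perpTo-⊥ k X))

  foot-on-perpTo : ∀ k X → foot k X I perpTo k X
  foot-on-perpTo k X = proj₁ (proj₂ (axB2 (perpTo-⊥ k X)))

  foot-on : ∀ k X → foot k X I k
  foot-on k X = proj₂ (proj₂ (axB2 (perpTo-⊥ k X)))

  perpTo-through-foot : ∀ {k m X} → m ⊥ k → foot k X I m → perpTo k X ≡ m
  perpTo-through-foot {k} {m} {X} m⊥k foot-m =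
    perpendicular-unique (foot-on k X) (foot-on-perpTo k X) (perpTo-⊥ k X) foot-m m⊥k

  -- Restricted to a line l not perpendicular to k, taking feet on k is
  -- injective: equal feet force a common perpendicular meeting l twice.
  foot-injective : ∀ {l k X Y} → ¬ (l ⊥ k) → X I l → Y I l →
                   foot k X ≡ foot k Y → X ≡ Y
  foot-injective {l} {k} {X} {Y} l⊥̸k Xl Yl same =
    perpendicular-meets-nonperpendicular-once (perpTo-⊥ k X) l⊥̸k
      (on-perpTo k X) Y-on-perpTo-X Xl Yl
    where
      same-perpendicular : perpTo k Y ≡ perpTo k X
      same-perpendicular =
        perpTo-through-foot (perpTo-⊥ k X) (subst (_I perpTo k X) same (foot-on-perpTo k X))
      Y-on-perpTo-X : Y I perpTo k X
      Y-on-perpTo-X = subst (Y I_) same-perpendicular (on-perpTo k Y)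

  -- A point of l off k has its foot on k off l, when l is not perpendicular
  -- to k: otherwise the point and its foot would be two common points.
  foot-leaves : ∀ {l k X} → ¬ (l ⊥ k) → X I l → ¬ (X I k) → ¬ (foot k X I l)
  foot-leaves {l} {k} {X} l⊥̸k Xl X∉k foot-l = X∉k (subst (_I k) (sym X≡foot) (foot-on k X))
    where
      X≡foot : X ≡ foot k X
      X≡foot = perpendicular-meets-nonperpendicular-once (perpTo-⊥ k X) l⊥̸k
                 (on-perpTo k X) (foot-on-perpTo k X) Xl foot-l

  module Exchange (ℓ n : Line) (R : Point) (R∉ℓ : ¬ (R I ℓ)) (Rn : R I n)
                  (n⊥̸ℓ : ¬ (n ⊥ ℓ)) where

    ℓ⊥̸n : ¬ (ℓ ⊥ n)
    ℓ⊥̸n ℓ⊥n = n⊥̸ℓ (axB1 ℓ⊥n)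

    data Region (X : Point) : Set where
      on-ℓ       : X I ℓ → Region X
      on-n-off-ℓ : ¬ (X I ℓ) → X I n → Region X
      off-both   : ¬ (X I ℓ) → ¬ (X I n) → Region X

    region : ∀ X → Region X
    region X with em {X I ℓ} | em {X I n}
    ... | yes Xℓ | _      = on-ℓ Xℓ
    ... | no X∉ℓ | yes Xn = on-n-off-ℓ X∉ℓ Xn
    ... | no X∉ℓ | no X∉n = off-both X∉ℓ X∉n

    exchangeAt : ∀ X → Region X → Point
    exchangeAt X (on-ℓ _)         = foot n X
    exchangeAt X (on-n-off-ℓ _ _) = foot ℓ X
    exchangeAt X (off-both _ _)   = X

    exchange : Point → Point
    exchange X = exchangeAt X (region X)

    -- The three regions have disjoint images and each piece is injective.
    exchangeAt-injective : ∀ X Y (rX : Region X) (rY : Region Y) →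
                           exchangeAt X rX ≡ exchangeAt Y rY → X ≡ Y
    exchangeAt-injective X Y (on-ℓ Xℓ) (on-ℓ Yℓ) e = foot-injective ℓ⊥̸n Xℓ Yℓ e
    exchangeAt-injective X Y (on-ℓ _) (on-n-off-ℓ Y∉ℓ Yn) e =
      ⊥-elim (foot-leaves n⊥̸ℓ Yn Y∉ℓ (subst (_I n) e (foot-on n X)))
    exchangeAt-injective X Y (on-ℓ _) (off-both _ Y∉n) e =
      ⊥-elim (Y∉n (subst (_I n) e (foot-on n X)))
    exchangeAt-injective X Y (on-n-off-ℓ X∉ℓ Xn) (on-ℓ _) e =
      ⊥-elim (foot-leaves n⊥̸ℓ Xn X∉ℓ (subst (_I n) (sym e) (foot-on n Y)))
    exchangeAt-injective X Y (on-n-off-ℓ _ Xn) (on-n-off-ℓ _ Yn) e =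
      foot-injective n⊥̸ℓ Xn Yn e
    exchangeAt-injective X Y (on-n-off-ℓ _ _) (off-both Y∉ℓ _) e =
      ⊥-elim (Y∉ℓ (subst (_I ℓ) e (foot-on ℓ X)))
    exchangeAt-injective X Y (off-both _ X∉n) (on-ℓ _) e =
      ⊥-elim (X∉n (subst (_I n) (sym e) (foot-on n Y)))
    exchangeAt-injective X Y (off-both X∉ℓ _) (on-n-off-ℓ _ _) e =
      ⊥-elim (X∉ℓ (subst (_I ℓ) (sym e) (foot-on ℓ Y)))
    exchangeAt-injective X Y (off-both _ _) (off-both _ _) e = e

    exchange-injective : ∀ X Y → exchange X ≡ exchange Y → X ≡ Y
    exchange-injective X Y = exchangeAt-injective X Y (region X) (region Y)

    -- If m ⊥ ℓ passes through R and meets ℓ at Z ≠ foot ℓ R, the map misses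
    -- Z: a preimage on ℓ would put Z on n, one on n \ ℓ would lie on m.
    exchange-misses : ∀ {m Z} → R I m → m ⊥ ℓ → Z I m → Z I ℓ →
                      foot ℓ R ≢ Z → ∀ X → exchange X ≢ Z
    exchange-misses {m} {Z} Rm m⊥ℓ Zm Zℓ foot≢Z X = missesAt (region X)
      where
        missesAt : (r : Region X) → exchangeAt X r ≢ Z
        missesAt (on-ℓ _) e = R∉ℓ (subst (_I ℓ) Z≡R Zℓ)
          where
            Z≡R : Z ≡ R
            Z≡R = perpendicular-meets-nonperpendicular-once m⊥ℓ n⊥̸ℓ
                    Zm Rm (subst (_I n) e (foot-on n X)) Rn
        missesAt (on-n-off-ℓ _ Xn) e = foot≢Z (subst (λ Y → foot ℓ Y ≡ Z) X≡R e)
          where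
            Xm : X I m
            Xm = subst (X I_) (perpTo-through-foot m⊥ℓ (subst (_I m) (sym e) Zm))
                   (on-perpTo ℓ X)
            X≡R : X ≡ R
            X≡R = perpendicular-meets-nonperpendicular-once m⊥ℓ n⊥̸ℓ Xm Rm Xn Rn
        missesAt (off-both X∉ℓ _) e = X∉ℓ (subst (_I ℓ) (sym e) Zℓ)

    -- In a finite plane the map misses nothing, so every perpendicular to ℓ
    -- through R is the dropped perpendicular perpTo ℓ R.
    module _ (finite : FinitePoints G) where
      perpendicular-meets-at-foot : ∀ {m Z} → R I m → m ⊥ ℓ → Z I m → Z I ℓ →
                                    Z ≡ foot ℓ R
      perpendicular-meets-at-foot Rm m⊥ℓ Zm Zℓ =
        em⇒dne em λ Z≢foot →
          injective-endomap-misses-nothing (proj₁ finite) (proj₁ (proj₂ finite))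
            (proj₂ (proj₂ finite)) exchange exchange-injective _
            (exchange-misses Rm m⊥ℓ Zm Zℓ (λ e → Z≢foot (sym e)))

      perpendicular-is-perpTo : ∀ {m} → R I m → m ⊥ ℓ → m ≡ perpTo ℓ R
      perpendicular-is-perpTo {m} Rm m⊥ℓ with Z , Zm , Zℓ ← axB2 m⊥ℓ =
        sym (perpTo-through-foot m⊥ℓ
               (subst (_I m) (perpendicular-meets-at-foot Rm m⊥ℓ Zm Zℓ) Zm))

lemma3p8 : ExcludedMiddle 0ℓ →
    (G : PartialSherkPlane) → FinitePoints G →
    let open PartialSherkPlane G in
    (ℓ : Line) (P : Point) → ¬ (P I ℓ) →
    (∀ (m : Line) → P I m → m ⊥ ℓ)
    ⊎ (Σ[ m ∈ Line ] ((P I m × m ⊥ ℓ) × (∀ (m' : Line) → P I m' → m' ⊥ ℓ → m' ≡ m)))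
lemma3p8 em G finite ℓ P P∉ℓ = by-cases em
  where
    open PartialSherkPlane G
    open SherkGeometry em G

    by-cases : Dec (∃[ n ] (P I n × ¬ (n ⊥ ℓ))) →
      (∀ (m : Line) → P I m → m ⊥ ℓ)
      ⊎ (Σ[ m ∈ Line ] ((P I m × m ⊥ ℓ) × (∀ (m' : Line) → P I m' → m' ⊥ ℓ → m' ≡ m)))
    by-cases (yes (n , Pn , n⊥̸ℓ)) =
      inj₂ (perpTo ℓ P , (on-perpTo ℓ P , perpTo-⊥ ℓ P) ,
            λ m Pm m⊥ℓ → Exchange.perpendicular-is-perpTo ℓ n P P∉ℓ Pn n⊥̸ℓ finite Pm m⊥ℓ)
    by-cases (no no-nonperpendicular) =
      inj₁ λ m Pm → em⇒dne em λ m⊥̸ℓ → no-nonperpendicular (m , Pm , m⊥̸ℓ)
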